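{- Let $M$ be a generalised common meadow satisfying $\mathsf{AVL}$. If $M$ has non-trivial zero divisors, i.e. there are $a,b\in M$ with $a\cdot b=0$, $a\neq0$ and $b\neq0$, then $M$ features non-trivial $\bot$-splitting, i.e. there are $c,d\in M$ with $c\neq\bot$, $d\neq\bot$ and $c+d=\bot$.
   Context: $\Sigma$ is the signature with constants $0,1,\bot$, unary $-$, binary $+,\cdot,\div$; $x\div y$ is written $\frac{x}{y}$. A generalised common meadow is a $\Sigma$-algebra satisfying all equations of $E_{\mathsf{ftc-cm}}$: $(x+y)+z=x+(y+z)$; $x+y=y+x$; $x+0=x$; $x+(-x)=0\cdot x$; $x\cdot(y\cdot z)=(x\cdot y)\cdot z$; $x\cdot y=y\cdot x$; $1\cdot x=x$; $x\cdot(y+z)=(x\cdot y)+(x\cdot z)$; $-(-x)=x$; $0\cdot(x\cdot x)=0\cdot x$; $x+\bot=\bot$; $x=\frac{x}{1}$; $\frac{x}{y}\cdot\frac{u}{v}=\frac{x\cdot u}{y\cdot v}$; $\frac{x}{y}+\frac{u}{v}=\frac{(x\cdot v)+(y\cdot u)}{y\cdot v}$; $\frac{x}{y+(0\cdot z)}=\frac{x+(0\cdot z)}{y}$; $\bot=\frac{1}{0}$. $\mathsf{AVL}$ is the conditional equation $\frac{1}{x}=\bot\to 0\cdot x=x$. -}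

module Defs where

open import Level using (Level; suc)
open import Relation.Binary.PropositionalEquality using (_≡_)

record SigmaAlgebra (ℓ : Level) : Set (suc ℓ) where
  infixl 6 _+_
  infixl 7 _·_ _÷_
  field
    Carrier : Set ℓ
    𝟘 𝟙 ⊥ₘ : Carrier
    -_ : Carrier → Carrier
    _+_ _·_ _÷_ : Carrier → Carrier → Carrier

record IsGeneralisedCommonMeadow {ℓ} (M : SigmaAlgebra ℓ) : Set ℓ where
  open SigmaAlgebra M
  field
    +-assoc   : ∀ x y z → (x + y) + z ≡ x + (y + z)
    +-comm    : ∀ x y → x + y ≡ y + x
    +-identʳ  : ∀ x → x + 𝟘 ≡ x
    +-inv     : ∀ x → x + (- x) ≡ 𝟘 · x
    ·-assoc   : ∀ x y z → x · (y · z) ≡ (x · y) · z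
    ·-comm    : ∀ x y → x · y ≡ y · x
    ·-identˡ  : ∀ x → 𝟙 · x ≡ x
    distrib   : ∀ x y z → x · (y + z) ≡ (x · y) + (x · z)
    neg-invol : ∀ x → - (- x) ≡ x
    zero-sq   : ∀ x → 𝟘 · (x · x) ≡ 𝟘 · x
    +-absorb  : ∀ x → x + ⊥ₘ ≡ ⊥ₘ
    div-one   : ∀ x → x ≡ x ÷ 𝟙
    div-mul   : ∀ x y u v → (x ÷ y) · (u ÷ v) ≡ (x · u) ÷ (y · v)
    div-add   : ∀ x y u v → (x ÷ y) + (u ÷ v) ≡ ((x · v) + (y · u)) ÷ (y · v)
    div-zero  : ∀ x y z → x ÷ (y + (𝟘 · z)) ≡ (x + (𝟘 · z)) ÷ y
    bot-def   : ⊥ₘ ≡ 𝟙 ÷ 𝟘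

AVL : ∀ {ℓ} → SigmaAlgebra ℓ → Set ℓ
AVL M = ∀ x → (𝟙 ÷ x) ≡ ⊥ₘ → (𝟘 · x) ≡ x
  where open SigmaAlgebra M

-- With a·b = 0 take c = 1/a and d = 1/b. Then c + d = (b + a)/(a·b) = (a + b)/0 = ⊥.
-- If 1/a were ⊥, AVL would give 0·a = a, making a an "error-like" element:
-- a·a = a and b + a = b, whence a = a·a + a·b = a·(a + b) = a·b = 0.
module Submission where

open import Defs
open import Level using (Level)
open import Data.Product using (Σ; _×_; _,_)
open import Relation.Binary.PropositionalEquality
  using (_≡_; _≢_; sym; trans; cong; cong₂; module ≡-Reasoning)

module GeneralisedCommonMeadowProperties
  {ℓ} {M : SigmaAlgebra ℓ} (G : IsGeneralisedCommonMeadow M) where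

  open SigmaAlgebra M
  open IsGeneralisedCommonMeadow G
  open ≡-Reasoning

  ·-identʳ : ∀ x → x · 𝟙 ≡ x
  ·-identʳ x = trans (·-comm x 𝟙) (·-identˡ x)

  +-identˡ : ∀ x → 𝟘 + x ≡ x
  +-identˡ x = trans (+-comm 𝟘 x) (+-identʳ x)

  x+x·𝟘≡x : ∀ x → x + x · 𝟘 ≡ x
  x+x·𝟘≡x x = begin
    x + x · 𝟘      ≡⟨ cong (_+ x · 𝟘) (sym (·-identʳ x)) ⟩
    x · 𝟙 + x · 𝟘  ≡⟨ sym (distrib x 𝟙 𝟘) ⟩
    x · (𝟙 + 𝟘)    ≡⟨ cong (x ·_) (+-identʳ 𝟙) ⟩
    x · 𝟙          ≡⟨ ·-identʳ x ⟩
    x              ∎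

  𝟘·𝟘≡𝟘 : 𝟘 · 𝟘 ≡ 𝟘
  𝟘·𝟘≡𝟘 = trans (sym (+-identˡ (𝟘 · 𝟘))) (x+x·𝟘≡x 𝟘)

  ÷≡·𝟙÷ : ∀ x y → x ÷ y ≡ x · (𝟙 ÷ y)
  ÷≡·𝟙÷ x y = begin
    x ÷ y                ≡⟨ cong₂ _÷_ (sym (·-identʳ x)) (sym (·-identˡ y)) ⟩
    (x · 𝟙) ÷ (𝟙 · y)    ≡⟨ sym (div-mul x 𝟙 𝟙 y) ⟩
    (x ÷ 𝟙) · (𝟙 ÷ y)    ≡⟨ cong (_· (𝟙 ÷ y)) (sym (div-one x)) ⟩
    x · (𝟙 ÷ y)          ∎

  ·⊥≡÷𝟘 : ∀ x → x · ⊥ₘ ≡ x ÷ 𝟘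
  ·⊥≡÷𝟘 x = trans (cong (x ·_) bot-def) (sym (÷≡·𝟙÷ x 𝟘))

  𝟘·x÷𝟘≡⊥ : ∀ x → (𝟘 · x) ÷ 𝟘 ≡ ⊥ₘ
  𝟘·x÷𝟘≡⊥ x = begin
    (𝟘 · x) ÷ 𝟘                ≡⟨ cong₂ _÷_ numerator (sym 𝟘·𝟘≡𝟘) ⟩
    (x · 𝟘 + 𝟘 · 𝟙) ÷ (𝟘 · 𝟘)  ≡⟨ sym (div-add x 𝟘 𝟙 𝟘) ⟩
    x ÷ 𝟘 + 𝟙 ÷ 𝟘              ≡⟨ cong (x ÷ 𝟘 +_) (sym bot-def) ⟩
    x ÷ 𝟘 + ⊥ₘ                 ≡⟨ +-absorb (x ÷ 𝟘) ⟩
    ⊥ₘ                         ∎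
    where
    numerator : 𝟘 · x ≡ x · 𝟘 + 𝟘 · 𝟙
    numerator = sym (trans (cong₂ _+_ (·-comm x 𝟘) (·-identʳ 𝟘)) (+-identʳ (𝟘 · x)))

  𝟘·⊥≡⊥ : 𝟘 · ⊥ₘ ≡ ⊥ₘ
  𝟘·⊥≡⊥ = trans (·⊥≡÷𝟘 𝟘) (trans (cong (_÷ 𝟘) (sym 𝟘·𝟘≡𝟘)) (𝟘·x÷𝟘≡⊥ 𝟘))

  x÷𝟘≡⊥ : ∀ x → x ÷ 𝟘 ≡ ⊥ₘ
  x÷𝟘≡⊥ x = begin
    x ÷ 𝟘          ≡⟨ sym (·⊥≡÷𝟘 x) ⟩
    x · ⊥ₘ         ≡⟨ cong (x ·_) (sym 𝟘·⊥≡⊥) ⟩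
    x · (𝟘 · ⊥ₘ)   ≡⟨ ·-assoc x 𝟘 ⊥ₘ ⟩
    (x · 𝟘) · ⊥ₘ   ≡⟨ cong (_· ⊥ₘ) (·-comm x 𝟘) ⟩
    (𝟘 · x) · ⊥ₘ   ≡⟨ ·⊥≡÷𝟘 (𝟘 · x) ⟩
    (𝟘 · x) ÷ 𝟘    ≡⟨ 𝟘·x÷𝟘≡⊥ x ⟩
    ⊥ₘ             ∎

  𝟙÷+𝟙÷≡⊥ : ∀ a b → a · b ≡ 𝟘 → 𝟙 ÷ a + 𝟙 ÷ b ≡ ⊥ₘ
  𝟙÷+𝟙÷≡⊥ a b ab≡𝟘 = begin
    𝟙 ÷ a + 𝟙 ÷ b                  ≡⟨ div-add 𝟙 a 𝟙 b ⟩
    (𝟙 · b + a · 𝟙) ÷ (a · b)      ≡⟨ cong (_ ÷_) ab≡𝟘 ⟩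
    (𝟙 · b + a · 𝟙) ÷ 𝟘            ≡⟨ x÷𝟘≡⊥ _ ⟩
    ⊥ₘ                             ∎

  x÷[𝟙+𝟘·z]≡x+𝟘·z : ∀ x z → x ÷ (𝟙 + 𝟘 · z) ≡ x + 𝟘 · z
  x÷[𝟙+𝟘·z]≡x+𝟘·z x z = trans (div-zero x 𝟙 z) (sym (div-one (x + 𝟘 · z)))

  x+𝟘·z≡x+x·𝟘·z : ∀ x z → x + 𝟘 · z ≡ x + x · (𝟘 · z)
  x+𝟘·z≡x+x·𝟘·z x z = begin
    x + 𝟘 · z                        ≡⟨ sym (x÷[𝟙+𝟘·z]≡x+𝟘·z x z) ⟩
    x ÷ (𝟙 + 𝟘 · z)                  ≡⟨ ÷≡·𝟙÷ x (𝟙 + 𝟘 · z) ⟩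
    x · (𝟙 ÷ (𝟙 + 𝟘 · z))            ≡⟨ cong (x ·_) (x÷[𝟙+𝟘·z]≡x+𝟘·z 𝟙 z) ⟩
    x · (𝟙 + 𝟘 · z)                  ≡⟨ distrib x 𝟙 (𝟘 · z) ⟩
    x · 𝟙 + x · (𝟘 · z)              ≡⟨ cong (_+ x · (𝟘 · z)) (·-identʳ x) ⟩
    x + x · (𝟘 · z)                  ∎

  𝟘·a≡a⇒a·a≡a : ∀ a → 𝟘 · a ≡ a → a · a ≡ a
  𝟘·a≡a⇒a·a≡a a 𝟘·a≡a = begin
    a · a          ≡⟨ cong (_· a) (sym 𝟘·a≡a) ⟩
    (𝟘 · a) · a    ≡⟨ sym (·-assoc 𝟘 a a) ⟩
    𝟘 · (a · a)    ≡⟨ zero-sq a ⟩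
    𝟘 · a          ≡⟨ 𝟘·a≡a ⟩
    a              ∎

  𝟘·a≡a⇒zero-divisor≡𝟘 : ∀ a b → 𝟘 · a ≡ a → a · b ≡ 𝟘 → a ≡ 𝟘
  𝟘·a≡a⇒zero-divisor≡𝟘 a b 𝟘·a≡a ab≡𝟘 = begin
    a              ≡⟨ sym (𝟘·a≡a⇒a·a≡a a 𝟘·a≡a) ⟩
    a · a          ≡⟨ sym (+-identˡ (a · a)) ⟩
    𝟘 + a · a      ≡⟨ cong (_+ a · a) (sym ab≡𝟘) ⟩
    a · b + a · a  ≡⟨ sym (distrib a b a) ⟩
    a · (b + a)    ≡⟨ cong (a ·_) b+a≡b ⟩
    a · b          ≡⟨ ab≡𝟘 ⟩
    𝟘              ∎
    where
    b+a≡b : b + a ≡ b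
    b+a≡b = begin
      b + a              ≡⟨ cong (b +_) (sym 𝟘·a≡a) ⟩
      b + 𝟘 · a          ≡⟨ x+𝟘·z≡x+x·𝟘·z b a ⟩
      b + b · (𝟘 · a)    ≡⟨ cong (λ t → b + b · t) 𝟘·a≡a ⟩
      b + b · a          ≡⟨ cong (b +_) (trans (·-comm b a) ab≡𝟘) ⟩
      b + 𝟘              ≡⟨ +-identʳ b ⟩
      b                  ∎

  avl⇒𝟙÷zero-divisor≢⊥ : AVL M → ∀ a b → a · b ≡ 𝟘 → a ≢ 𝟘 → 𝟙 ÷ a ≢ ⊥ₘ
  avl⇒𝟙÷zero-divisor≢⊥ avl a b ab≡𝟘 a≢𝟘 𝟙÷a≡⊥ =
    a≢𝟘 (𝟘·a≡a⇒zero-divisor≡𝟘 a b (avl a 𝟙÷a≡⊥) ab≡𝟘)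

mainTheorem10 : ∀ {ℓ : Level} (M : SigmaAlgebra ℓ) → IsGeneralisedCommonMeadow M → AVL M →
    Σ (SigmaAlgebra.Carrier M) (λ a → Σ (SigmaAlgebra.Carrier M) (λ b →
      (SigmaAlgebra._·_ M a b ≡ SigmaAlgebra.𝟘 M) × (a ≢ SigmaAlgebra.𝟘 M) × (b ≢ SigmaAlgebra.𝟘 M))) →
    Σ (SigmaAlgebra.Carrier M) (λ c → Σ (SigmaAlgebra.Carrier M) (λ d →
      (c ≢ SigmaAlgebra.⊥ₘ M) × (d ≢ SigmaAlgebra.⊥ₘ M) × (SigmaAlgebra._+_ M c d ≡ SigmaAlgebra.⊥ₘ M)))
mainTheorem10 M G avl (a , b , ab≡𝟘 , a≢𝟘 , b≢𝟘) =
  𝟙 ÷ a , 𝟙 ÷ b ,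
  avl⇒𝟙÷zero-divisor≢⊥ avl a b ab≡𝟘 a≢𝟘 ,
  avl⇒𝟙÷zero-divisor≢⊥ avl b a (trans (·-comm b a) ab≡𝟘) b≢𝟘 ,
  𝟙÷+𝟙÷≡⊥ a b ab≡𝟘
  where
  open SigmaAlgebra M
  open IsGeneralisedCommonMeadow G using (·-comm)
  open GeneralisedCommonMeadowProperties G
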